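{- Let $G=(V,E)$ be a matching-covered graph. Then the following statements are equivalent: (1) $G$ is bipartite; (2) the set of non-feasible edge sets of $G$ equals $\{X\subseteq E: X\sim_G \emptyset\}$; (3) the set of non-feasible edge sets of $G$ equals $\{X\subseteq E: X\sim_G E\}$.
   Context: Graphs are finite, undirected and loopless. A perfect matching of $G$ is a set of independent edges covering all vertices. $G$ is matching-covered if it is connected and every edge lies in some perfect matching of $G$. An edge set $X\subseteq E$ is feasible if there are perfect matchings $M_1,M_2$ of $G$ with $|M_1\cap X|\not\equiv |M_2\cap X| \pmod 2$; otherwise $X$ is non-feasible. For $V_0\subseteq V$, $\nabla_G(V_0)$ denotes the set of edges of $G$ with exactly one end in $V_0$. For $X,Y\subseteq E$, $X\sim_G Y$ (switching-equivalent) means $X=Y\oplus \nabla_G(V_0)$ for some $V_0\subseteq V$, where $\oplus$ is symmetric difference. -}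

module Defs where

open import Data.Nat using (ℕ; _%_)
open import Data.Bool using (Bool; true; false; _xor_; _∨_)
open import Data.Fin using (Fin; _≟_)
open import Data.Fin.Subset using (Subset; _∩_; ∣_∣; ⊥; ⊤)
open import Data.Vec using (tabulate; zipWith; lookup)
open import Data.Product using (Σ; ∃; ∃-syntax; _×_; _,_; proj₁; proj₂)
open import Data.Sum using (_⊎_)
open import Relation.Nullary using (¬_; ⌊_⌋)
open import Relation.Binary.PropositionalEquality using (_≡_; _≢_)

record Graph : Set where
  field
    n        : ℕ
    m        : ℕ
    ends     : Fin m → Fin n × Fin n
    loopless : ∀ e → proj₁ (ends e) ≢ proj₂ (ends e)

module _ (G : Graph) where
  open Graph G

  Vertex : Set
  Vertex = Fin n

  EdgeSet : Set
  EdgeSet = Subset m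

  VertexSet : Set
  VertexSet = Subset n

  incident : Vertex → Fin m → Bool
  incident v e = ⌊ v ≟ proj₁ (ends e) ⌋ ∨ ⌊ v ≟ proj₂ (ends e) ⌋

  star : Vertex → EdgeSet
  star v = tabulate (incident v)

  IsPerfectMatching : EdgeSet → Set
  IsPerfectMatching M = ∀ v → ∣ M ∩ star v ∣ ≡ 1

  Adjacent : Vertex → Vertex → Set
  Adjacent u v = ∃[ e ] (ends e ≡ (u , v) ⊎ ends e ≡ (v , u))

  data Reachable : Vertex → Vertex → Set where
    here : ∀ {u} → Reachable u u
    step : ∀ {u v w} → Adjacent u v → Reachable v w → Reachable u w

  Connected : Set
  Connected = ∀ u v → Reachable u v

  MatchingCovered : Set
  MatchingCovered =
    Connected × (∀ e → ∃[ M ] (IsPerfectMatching M × lookup M e ≡ true))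

  Bipartite : Set
  Bipartite = ∃[ c ] (∀ (e : Fin m) →
    lookup c (proj₁ (ends e)) ≢ lookup {A = Bool} c (proj₂ (ends e)))

  Feasible : EdgeSet → Set
  Feasible X = ∃[ M₁ ] ∃[ M₂ ] (IsPerfectMatching M₁ × IsPerfectMatching M₂ ×
    ∣ M₁ ∩ X ∣ % 2 ≢ ∣ M₂ ∩ X ∣ % 2)

  NonFeasible : EdgeSet → Set
  NonFeasible X = ¬ Feasible X

  _⊕_ : EdgeSet → EdgeSet → EdgeSet
  X ⊕ Y = zipWith _xor_ X Y

  ∇ : VertexSet → EdgeSet
  ∇ V₀ = tabulate (λ e → lookup V₀ (proj₁ (ends e)) xor lookup V₀ (proj₂ (ends e)))

  _∼_ : EdgeSet → EdgeSet → Set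
  X ∼ Y = ∃[ V₀ ] (X ≡ Y ⊕ ∇ V₀)

  ∅ₑ : EdgeSet
  ∅ₑ = ⊥

  Eₑ : EdgeSet
  Eₑ = ⊤

module Submission where

open import Defs
open import Algebra.Bundles using (CommutativeSemiring; CommutativeRing)
open import Data.Bool.Base using (Bool; true; false; _xor_; _∧_; _∨_; not; if_then_else_)
open import Data.Bool.Properties as Bool using (xor-∧-commutativeRing)
open import Data.Empty using (⊥-elim)
open import Data.Fin.Base using (Fin; zero; suc; toℕ)
open import Data.Fin.Properties using (_≟_; suc-injective; pigeonhole; ¬Fin0)
open import Data.Fin.Subset using (Subset; _∩_; ∣_∣; ⊥)
open import Data.Fin.Subset.Properties using (∩-zeroʳ; ∩-identityʳ)
open import Data.List.Base using (List; []; _∷_; _++_; _∷ʳ_; map; foldr)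
open import Data.List.Membership.Propositional using (_∈_; _∉_)
open import Data.List.Membership.Propositional.Properties using (∈-map⁺; ∈-map⁻)
open import Data.List.Relation.Unary.All using ([])
import Data.List.Relation.Unary.All.Properties as All
open import Data.List.Relation.Unary.AllPairs using ([]; _∷_)
open import Data.List.Relation.Unary.Any using (here; there; any?)
open import Data.List.Relation.Unary.Unique.Propositional using (Unique)
import Data.List.Relation.Unary.Unique.Propositional.Properties as Unique
open import Data.List.Relation.Binary.Permutation.Propositional using (_↭_; ↭-refl; ↭-sym; ↭⇒↭ₛ)
open import Data.List.Relation.Binary.Permutation.Propositional.Properties using (∷↭∷ʳ; ∈-resp-↭)
import Data.List.Relation.Binary.Permutation.Setoid.Properties as ↭ₛ
open import Data.Nat.Base as ℕ using (ℕ; _%_)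
open import Data.Nat.DivMod using (%-distribˡ-+)
open import Data.Nat.Properties as ℕ using (+-*-commutativeSemiring)
open import Data.Product using (∃!; ∃-syntax; Σ-syntax; _×_; _,_; proj₁; proj₂)
open import Data.Sum.Base using (_⊎_; inj₁; inj₂)
open import Data.Vec.Base using (Vec; []; _∷_; lookup; tabulate; zipWith)
open import Data.Vec.Properties
  using (lookup-zipWith; lookup∘tabulate; tabulate∘lookup; tabulate-cong; lookup-replicate; map-id;
         zipWith-assoc; zipWith-identityʳ; zipWith-inverseʳ)
open import Function.Base using (_∘_)
open import Function.Bundles using (_⇔_; mk⇔; Equivalence)
open import Function.Construct.Symmetry using (⇔-sym)
open import Relation.Binary.PropositionalEquality
open import Relation.Nullary using (¬_; contradiction)
open import Relation.Nullary.Decidable using (Dec; does; yes; no; dec-true; dec-false)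
open import Algebra.Properties.CommutativeSemigroup (CommutativeRing.+-commutativeSemigroup xor-∧-commutativeRing)
  using (interchange)

-- Every perfect matching meets a cut ∇(V₀) in |V₀| edges modulo 2 and has n/2 edges, so edge
-- sets switching-equivalent to ∅ or to E are non-feasible; and E = ∇(A) exactly when G is
-- bipartite with colour class A. Conversely let G be bipartite, fix a perfect matching M₀ and
-- switch X until it avoids M₀. Contract every M₀-edge onto its end of colour true and direct the
-- edges from colour true to colour false: directed cycles are M₀-alternating cycles,
-- and exchanging M₀ along one gives a perfect matching, so non-feasibility makes every directed
-- cycle even for X. Matching-coveredness puts every arc on a directed cycle, so the contraction
-- is strongly connected, and the parity of walks from a fixed root is a potential p with X = ∇(p).

xor-transpose : ∀ a {b c} → a xor b ≡ c → a xor c ≡ b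
xor-transpose false refl = refl
xor-transpose true  refl = Bool.not-involutive _

∧-true⁻ : ∀ {x y} → x ∧ y ≡ true → x ≡ true × y ≡ true
∧-true⁻ {true} {true} _ = refl , refl

xor-sum : List Bool → Bool
xor-sum = foldr _xor_ false

infix 4 _∈?_

_∈?_ : ∀ {k} (x : Fin k) (xs : List (Fin k)) → Dec (x ∈ xs)
x ∈? xs = any? (x ≟_) xs

Unique-++⁻ : ∀ {A : Set} (xs : List A) {ys} → Unique (xs ++ ys) →
             Unique xs × Unique ys × (∀ {v} → v ∈ xs → v ∉ ys)
Unique-++⁻ []       unique          = [] , unique , λ ()
Unique-++⁻ (x ∷ xs) (x∉ ∷ unique) with Unique-++⁻ xs unique
... | unique-xs , unique-ys , disjoint = All.++⁻ˡ xs x∉ ∷ unique-xs , unique-ys , λ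
  { (here refl) → All.All¬⇒¬Any (All.++⁻ʳ xs x∉) ; (there v∈xs) → disjoint v∈xs }

Unique-map⇒injective : ∀ {A B : Set} (f : A → B) {xs x y} → Unique (map f xs) →
                       x ∈ xs → y ∈ xs → f x ≡ f y → x ≡ y
Unique-map⇒injective f {_ ∷ xs} _            (here refl) (here refl) _     = refl
Unique-map⇒injective f {_ ∷ xs} (fx∉ ∷ _)    (here refl) (there y∈)  fx≡fy =
  ⊥-elim (All.All¬⇒¬Any fx∉ (subst (_∈ map f xs) (sym fx≡fy) (∈-map⁺ f y∈)))
Unique-map⇒injective f {_ ∷ xs} (fy∉ ∷ _)    (there x∈)  (here refl) fx≡fy =
  ⊥-elim (All.All¬⇒¬Any fy∉ (subst (_∈ map f xs) fx≡fy (∈-map⁺ f x∈)))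
Unique-map⇒injective f {_ ∷ xs} (_ ∷ unique) (there x∈)  (there y∈)  fx≡fy =
  Unique-map⇒injective f unique x∈ y∈ fx≡fy

Unique-resp-↭ : ∀ {A : Set} {xs ys : List A} → xs ↭ ys → Unique xs → Unique ys
Unique-resp-↭ {A} xs↭ys = ↭ₛ.Unique-resp-↭ (setoid A) (↭⇒↭ₛ xs↭ys)

lookup-≗⇒≡ : ∀ {A : Set} {k} {xs ys : Vec A k} → (∀ i → lookup xs i ≡ lookup ys i) → xs ≡ ys
lookup-≗⇒≡ {xs = xs} {ys} eq = trans (sym (tabulate∘lookup xs)) (trans (tabulate-cong eq) (tabulate∘lookup ys))

lookup-∩ : ∀ {k} (p q : Subset k) i → lookup (p ∩ q) i ≡ lookup p i ∧ lookup q i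
lookup-∩ p q i = lookup-zipWith _∧_ i p q

lookup-xor : ∀ {k} (p q : Subset k) i → lookup (zipWith _xor_ p q) i ≡ lookup p i xor lookup q i
lookup-xor p q i = lookup-zipWith _xor_ i p q

-- Finite sums and parity

module DoubleCounting {c ℓ} (R : CommutativeSemiring c ℓ) where
  open CommutativeSemiring R hiding (zero) renaming (sym to ≈-sym; trans to ≈-trans; setoid to ≈-setoid)
  open import Algebra.Properties.Semiring.Sum semiring public
  open import Relation.Binary.Reasoning.Setoid ≈-setoid
  open import Algebra.Properties.CommutativeSemigroup *-commutativeSemigroup using (x∙yz≈y∙xz)

  δ : ∀ {k} → Fin k → Fin k → Carrier
  δ v u = if does (v ≟ u) then 1# else 0#

  ∑-δ : ∀ {k} (w : Fin k → Carrier) u → ∑[ v < k ] (w v * δ v u) ≈ w u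
  ∑-δ {ℕ.suc k} w zero = begin
    w zero * 1# + ∑[ v < k ] (w (suc v) * 0#)
      ≈⟨ +-cong (*-identityʳ _) (≈-trans (sum-cong-≋ {k} (λ v → zeroʳ (w (suc v)))) (sum-replicate-zero k)) ⟩
    w zero + 0#
      ≈⟨ +-identityʳ _ ⟩
    w zero
      ∎
  ∑-δ {ℕ.suc k} w (suc u) = begin
    w zero * 0# + ∑[ v < k ] (w (suc v) * δ v u)  ≈⟨ +-cong (zeroʳ _) (∑-δ (λ v → w (suc v)) u) ⟩
    0# + w (suc u)                                ≈⟨ +-identityˡ _ ⟩
    w (suc u)                                     ∎

  handshake : ∀ {n m} (end₁ end₂ : Fin m → Fin n) (s : Fin m → Carrier) (w : Fin n → Carrier) →
              ∑[ v < n ] (w v * ∑[ e < m ] (s e * (δ v (end₁ e) + δ v (end₂ e))))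
              ≈ ∑[ e < m ] (s e * (w (end₁ e) + w (end₂ e)))
  handshake {n} {m} end₁ end₂ s w = begin
    ∑[ v < n ] (w v * ∑[ e < m ] (s e * d v e))
      ≈⟨ sum-cong-≋ {n} (λ v → *-distribˡ-sum {m} (w v) _) ⟩
    ∑[ v < n ] ∑[ e < m ] (w v * (s e * d v e))
      ≈⟨ ∑-comm {n} {m} _ ⟩
    ∑[ e < m ] ∑[ v < n ] (w v * (s e * d v e))
      ≈⟨ sum-cong-≋ {m} (λ e → sum-cong-≋ {n} (λ v → x∙yz≈y∙xz (w v) (s e) (d v e))) ⟩
    ∑[ e < m ] ∑[ v < n ] (s e * (w v * d v e))
      ≈⟨ sum-cong-≋ {m} (λ e → ≈-sym (*-distribˡ-sum {n} (s e) _)) ⟩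
    ∑[ e < m ] (s e * ∑[ v < n ] (w v * d v e))
      ≈⟨ sum-cong-≋ {m} (λ e → *-congˡ (weight-of-ends e)) ⟩
    ∑[ e < m ] (s e * (w (end₁ e) + w (end₂ e)))
      ∎
    where
    d : Fin n → Fin m → Carrier
    d v e = δ v (end₁ e) + δ v (end₂ e)
    weight-of-ends : ∀ e → ∑[ v < n ] (w v * d v e) ≈ w (end₁ e) + w (end₂ e)
    weight-of-ends e = begin
      ∑[ v < n ] (w v * d v e)
        ≈⟨ sum-cong-≋ {n} (λ v → distribˡ (w v) _ _) ⟩
      ∑[ v < n ] (w v * δ v (end₁ e) + w v * δ v (end₂ e))
        ≈⟨ ∑-distrib-+ {n} _ _ ⟩
      ∑[ v < n ] (w v * δ v (end₁ e)) + ∑[ v < n ] (w v * δ v (end₂ e))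
        ≈⟨ +-cong (∑-δ w (end₁ e)) (∑-δ w (end₂ e)) ⟩
      w (end₁ e) + w (end₂ e)
        ∎

module Parity = DoubleCounting (CommutativeRing.commutativeSemiring xor-∧-commutativeRing)
module Count = DoubleCounting +-*-commutativeSemiring

bit : Bool → ℕ
bit false = 0
bit true  = 1

bit-injective : ∀ {x y} → bit x ≡ bit y → x ≡ y
bit-injective {false} {false} _ = refl
bit-injective {true}  {true}  _ = refl

bit-∧ : ∀ x y → bit (x ∧ y) ≡ bit x ℕ.* bit y
bit-∧ false y = refl
bit-∧ true  y = sym (ℕ.+-identityʳ (bit y))

∑1≡n : ∀ n → Count.∑[ i < n ] 1 ≡ n
∑1≡n ℕ.zero    = refl
∑1≡n (ℕ.suc n) = cong ℕ.suc (∑1≡n n)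

parity : ∀ {k} → Subset k → Bool
parity p = Parity.sum (lookup p)

∣p∣%2≡bit-parity : ∀ {k} (p : Subset k) → ∣ p ∣ % 2 ≡ bit (parity p)
∣p∣%2≡bit-parity []          = refl
∣p∣%2≡bit-parity (false ∷ p) = ∣p∣%2≡bit-parity p
∣p∣%2≡bit-parity (true  ∷ p) = begin
  ℕ.suc ∣ p ∣ % 2                ≡⟨ %-distribˡ-+ 1 ∣ p ∣ 2 ⟩
  (1 ℕ.+ ∣ p ∣ % 2) % 2          ≡⟨ cong (λ r → ℕ.suc r % 2) (∣p∣%2≡bit-parity p) ⟩
  ℕ.suc (bit (parity p)) % 2     ≡⟨ flip (parity p) ⟩
  bit (not (parity p))           ∎
  where
  open ≡-Reasoning
  flip : ∀ b → ℕ.suc (bit b) % 2 ≡ bit (not b)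
  flip false = refl
  flip true  = refl

%2≡⇒parity≡ : ∀ {k} (p q : Subset k) → ∣ p ∣ % 2 ≡ ∣ q ∣ % 2 → parity p ≡ parity q
%2≡⇒parity≡ p q counts≡ = bit-injective (trans (sym (∣p∣%2≡bit-parity p)) (trans counts≡ (∣p∣%2≡bit-parity q)))

parity≡⇒%2≡ : ∀ {k} (p q : Subset k) → parity p ≡ parity q → ∣ p ∣ % 2 ≡ ∣ q ∣ % 2
parity≡⇒%2≡ p q parities≡ = trans (∣p∣%2≡bit-parity p) (trans (cong bit parities≡) (sym (∣p∣%2≡bit-parity q)))

∣p∣≡∑bit : ∀ {k} (p : Subset k) → ∣ p ∣ ≡ Count.∑[ i < k ] bit (lookup p i)
∣p∣≡∑bit []          = refl
∣p∣≡∑bit (false ∷ p) = ∣p∣≡∑bit p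
∣p∣≡∑bit (true  ∷ p) = cong ℕ.suc (∣p∣≡∑bit p)

parity-∩-xor : ∀ {k} (p q r : Subset k) → parity (p ∩ zipWith _xor_ q r) ≡ parity (p ∩ q) xor parity (p ∩ r)
parity-∩-xor {k} p q r = trans (Parity.sum-cong-≋ {k} distrib) (Parity.∑-distrib-+ {k} _ _)
  where
  distrib : ∀ i → lookup (p ∩ zipWith _xor_ q r) i ≡ lookup (p ∩ q) i xor lookup (p ∩ r) i
  distrib i = begin
    lookup (p ∩ zipWith _xor_ q r) i                    ≡⟨ trans (lookup-∩ p _ i) (cong (lookup p i ∧_) (lookup-xor q r i)) ⟩
    lookup p i ∧ (lookup q i xor lookup r i)            ≡⟨ Bool.∧-distribˡ-xor (lookup p i) _ _ ⟩
    lookup p i ∧ lookup q i xor lookup p i ∧ lookup r i ≡⟨ sym (cong₂ _xor_ (lookup-∩ p q i) (lookup-∩ p r i)) ⟩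
    lookup (p ∩ q) i xor lookup (p ∩ r) i               ∎
    where open ≡-Reasoning

∑-∈ : ∀ {k} (f : Fin k → Bool) {xs} → Unique xs → Parity.∑[ i < k ] (does (i ∈? xs) ∧ f i) ≡ xor-sum (map f xs)
∑-∈ {k} f {[]}     _               = Parity.sum-replicate-zero k
∑-∈ {k} f {x ∷ xs} (x∉xs ∷ unique) = begin
  Parity.∑[ i < k ] (does (i ∈? x ∷ xs) ∧ f i)
    ≡⟨ Parity.sum-cong-≋ {k} split ⟩
  Parity.∑[ i < k ] (f i ∧ Parity.δ i x xor does (i ∈? xs) ∧ f i)
    ≡⟨ Parity.∑-distrib-+ {k} _ _ ⟩
  Parity.∑[ i < k ] (f i ∧ Parity.δ i x) xor Parity.∑[ i < k ] (does (i ∈? xs) ∧ f i)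
    ≡⟨ cong₂ _xor_ (Parity.∑-δ f x) (∑-∈ f unique) ⟩
  f x xor xor-sum (map f xs)
    ∎
  where
  open ≡-Reasoning
  split : ∀ i → does (i ∈? x ∷ xs) ∧ f i ≡ f i ∧ Parity.δ i x xor does (i ∈? xs) ∧ f i
  split i with i ≟ x | i ∈? xs
  ... | yes refl | yes x∈xs = ⊥-elim (All.All¬⇒¬Any x∉xs x∈xs)
  ... | yes _    | no  _    = sym (trans (Bool.xor-identityʳ _) (Bool.∧-identityʳ (f i)))
  ... | no  _    | yes _    = sym (cong (_xor f i) (Bool.∧-zeroʳ (f i)))
  ... | no  _    | no  _    = sym (trans (Bool.xor-identityʳ _) (Bool.∧-zeroʳ (f i)))

∣p∣≡0⇒empty : ∀ {k} (p : Subset k) → ∣ p ∣ ≡ 0 → ∀ i → lookup p i ≡ false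
∣p∣≡0⇒empty (false ∷ p) ∣p∣≡0 zero    = refl
∣p∣≡0⇒empty (false ∷ p) ∣p∣≡0 (suc i) = ∣p∣≡0⇒empty p ∣p∣≡0 i

empty⇒∣p∣≡0 : ∀ {k} (p : Subset k) → (∀ i → lookup p i ≡ false) → ∣ p ∣ ≡ 0
empty⇒∣p∣≡0 []          _     = refl
empty⇒∣p∣≡0 (false ∷ p) empty = empty⇒∣p∣≡0 p (λ i → empty (suc i))
empty⇒∣p∣≡0 (true  ∷ p) empty with empty zero
... | ()

∣p∣≡1⇒∃! : ∀ {k} (p : Subset k) → ∣ p ∣ ≡ 1 → ∃! _≡_ (λ i → lookup p i ≡ true)
∣p∣≡1⇒∃! (true ∷ p) ∣p∣≡1 = zero , refl , only-zero
  where
  only-zero : ∀ {j} → lookup (true ∷ p) j ≡ true → zero ≡ j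
  only-zero {zero}  _   = refl
  only-zero {suc j} p∋j with trans (sym (∣p∣≡0⇒empty p (ℕ.suc-injective ∣p∣≡1) j)) p∋j
  ... | ()
∣p∣≡1⇒∃! (false ∷ p) ∣p∣≡1 =
  let i , p∋i , unique = ∣p∣≡1⇒∃! p ∣p∣≡1 in suc i , p∋i , only-suc unique
  where
  only-suc : ∀ {i} → (∀ {j} → lookup p j ≡ true → i ≡ j) → ∀ {j} → lookup (false ∷ p) j ≡ true → suc i ≡ j
  only-suc unique {suc j} p∋j = cong suc (unique p∋j)

∃!⇒∣p∣≡1 : ∀ {k} (p : Subset k) → ∃! _≡_ (λ i → lookup p i ≡ true) → ∣ p ∣ ≡ 1
∃!⇒∣p∣≡1 (true  ∷ p) (zero  , _   , unique) = cong ℕ.suc (empty⇒∣p∣≡0 p none)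
  where
  none : ∀ i → lookup p i ≡ false
  none i with lookup p i in p∋i
  ... | false = refl
  ... | true  with unique {suc i} p∋i
  ... | ()
∃!⇒∣p∣≡1 (false ∷ p) (suc i , p∋i , unique) = ∃!⇒∣p∣≡1 p (i , p∋i , λ p∋j → suc-injective (unique p∋j))
∃!⇒∣p∣≡1 (true  ∷ p) (suc i , _   , unique) with unique {zero} refl
... | ()

∃!-cong : ∀ {k} {P Q : Fin k → Set} → (∀ i → P i ⇔ Q i) → ∃! _≡_ P → ∃! _≡_ Q
∃!-cong P⇔Q (i , Pi , unique) = i , Equivalence.to (P⇔Q i) Pi , λ Qj → unique (Equivalence.from (P⇔Q _) Qj)

module Iteration {k} (f : Fin k → Fin k) (P : Fin k → Set) (f-closed : ∀ {x} → P x → P (f x))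
                 (f-injective : ∀ {x y} → P x → P y → f x ≡ f y → x ≡ y) where

  iterate : ℕ → Fin k → Fin k
  iterate ℕ.zero    x = x
  iterate (ℕ.suc i) x = f (iterate i x)

  iterate-closed : ∀ i {x} → P x → P (iterate i x)
  iterate-closed ℕ.zero    Px = Px
  iterate-closed (ℕ.suc i) Px = f-closed (iterate-closed i Px)

  iterate-injective : ∀ i {x y} → P x → P y → iterate i x ≡ iterate i y → x ≡ y
  iterate-injective ℕ.zero    _  _  eq = eq
  iterate-injective (ℕ.suc i) Px Py eq =
    iterate-injective i Px Py (f-injective (iterate-closed i Px) (iterate-closed i Py) eq)

  iterate-+ : ∀ i j x → iterate (i ℕ.+ j) x ≡ iterate i (iterate j x)
  iterate-+ ℕ.zero    j x = refl
  iterate-+ (ℕ.suc i) j x = cong f (iterate-+ i j x)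

  iterate-returns : ∀ {x} → P x → Σ[ o ∈ ℕ ] iterate (ℕ.suc o) x ≡ x
  iterate-returns {x} Px =
    let i , j , i<j , same = pigeonhole (ℕ.n<1+n k) (λ i → iterate (toℕ i) x)
        o , i+1+o≡j = ℕ.m≤n⇒∃[o]m+o≡n i<j
        j≡i+[1+o] = trans (sym i+1+o≡j) (sym (ℕ.+-suc (toℕ i) o))
    in o , sym (iterate-injective (toℕ i) Px (iterate-closed (ℕ.suc o) Px)
             (trans same (trans (cong (λ l → iterate l x) j≡i+[1+o]) (iterate-+ (toℕ i) (ℕ.suc o) x))))

-- Walks in a digraph with arcs weighted in ℤ₂

module Digraph {k} {Arc : Set} (src tgt : Arc → Fin k) (w : Arc → Bool) where

  infixr 5 _∷_ _++ᵂ_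

  data Walk : Fin k → Fin k → Set where
    []  : ∀ {x} → Walk x x
    _∷_ : ∀ a {y} → Walk (tgt a) y → Walk (src a) y

  arcs : ∀ {x y} → Walk x y → List Arc
  arcs []      = []
  arcs (a ∷ W) = a ∷ arcs W

  sources targets : ∀ {x y} → Walk x y → List (Fin k)
  sources W = map src (arcs W)
  targets W = map tgt (arcs W)

  weight : ∀ {x y} → Walk x y → Bool
  weight W = xor-sum (map w (arcs W))

  SimpleCycle : ∀ {x} → Walk x x → Set
  SimpleCycle C = Unique (targets C)

  _++ᵂ_ : ∀ {x y z} → Walk x y → Walk y z → Walk x z
  []      ++ᵂ V = V
  (a ∷ W) ++ᵂ V = a ∷ (W ++ᵂ V)

  weight-++ : ∀ {x y z} (W : Walk x y) (V : Walk y z) → weight (W ++ᵂ V) ≡ weight W xor weight V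
  weight-++ []      V = refl
  weight-++ (a ∷ W) V = trans (cong (w a xor_) (weight-++ W V)) (sym (Bool.xor-assoc (w a) (weight W) (weight V)))

  sources-∷ʳ : ∀ {x y} (W : Walk x y) → sources W ∷ʳ y ≡ x ∷ targets W
  sources-∷ʳ []      = refl
  sources-∷ʳ (a ∷ W) = cong (src a ∷_) (sources-∷ʳ W)

  closed-sources↭targets : ∀ {x} (C : Walk x x) → sources C ↭ targets C
  closed-sources↭targets []      = ↭-refl
  closed-sources↭targets (a ∷ W) = subst (src a ∷ sources W ↭_) (sources-∷ʳ W) (∷↭∷ʳ (src a) (sources W))

  end∈ : ∀ {x y} (W : Walk x y) → y ∈ x ∷ targets W
  end∈ []      = here refl
  end∈ (a ∷ W) = there (end∈ W)

  splitAt : ∀ {x y v} (W : Walk x y) → v ∈ targets W →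
            Σ[ A ∈ Walk x v ] Σ[ B ∈ Walk v y ]
              (targets W ≡ targets A ++ targets B × weight W ≡ weight A xor weight B × v ∈ targets A)
  splitAt (a ∷ W) (here refl) = a ∷ [] , W , refl , cong (_xor weight W) (sym (Bool.xor-identityʳ (w a))) , here refl
  splitAt (a ∷ W) (there v∈W) with splitAt W v∈W
  ... | A , B , targets≡ , weight≡ , v∈A =
    a ∷ A , B , cong (tgt a ∷_) targets≡ ,
    trans (cong (w a xor_) weight≡) (sym (Bool.xor-assoc (w a) (weight A) (weight B))) , there v∈A

  module _ (simple-cycle-even : ∀ {x} (C : Walk x x) → SimpleCycle C → weight C ≡ false) where

    cut-at-start : ∀ {x y} (W : Walk x y) → Unique (targets W) → x ∈ targets W →
                   Σ[ P ∈ Walk x y ] (Unique (x ∷ targets P) × weight P ≡ weight W)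
    cut-at-start W unique-W x∈W with splitAt W x∈W
    ... | A , B , targets≡ , weight≡ , x∈A with Unique-++⁻ (targets A) (subst Unique targets≡ unique-W)
    ... | unique-A , unique-B , disjoint =
      B , All.¬Any⇒All¬ _ (disjoint x∈A) ∷ unique-B ,
      sym (trans weight≡ (cong (_xor weight B) (simple-cycle-even A unique-A)))

    shortcut : ∀ {x y} (W : Walk x y) → Σ[ P ∈ Walk x y ] (Unique (x ∷ targets P) × weight P ≡ weight W)
    shortcut []      = [] , [] ∷ [] , refl
    shortcut (a ∷ W) with shortcut W
    ... | P , unique-P , weight-P with src a ∈? targets (a ∷ P)
    ... | no  x∉ = a ∷ P , All.¬Any⇒All¬ _ x∉ ∷ unique-P , cong (w a xor_) weight-P
    ... | yes x∈ = let Q , unique-Q , weight-Q = cut-at-start (a ∷ P) unique-P x∈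
                   in Q , unique-Q , trans weight-Q (cong (w a xor_) weight-P)

    closed-walk-even : ∀ {x} (C : Walk x x) → weight C ≡ false
    closed-walk-even C with shortcut C
    ... | []    , _              , weight≡ = sym weight≡
    ... | a ∷ P , x∉targets ∷ _ , _       = ⊥-elim (All.All¬⇒¬Any x∉targets (end∈ P))

    weight-unique : ∀ {x y} (P Q : Walk x y) → Walk y x → weight P ≡ weight Q
    weight-unique P Q R = trans (returns (P ++ᵂ R) (weight-++ P R)) (sym (returns (Q ++ᵂ R) (weight-++ Q R)))
      where
      returns : ∀ {x b} (C : Walk x x) → weight C ≡ b xor weight R → b ≡ weight R
      returns {b = b} C weight-C =
        trans (sym (Bool.xor-identityʳ b)) (xor-transpose b (trans (sym weight-C) (closed-walk-even C)))

  return-walk : ∀ (f : Fin k → Fin k) (P : Fin k → Set) (f-closed : ∀ {x} → P x → P (f x))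
                (f-injective : ∀ {x y} → P x → P y → f x ≡ f y → x ≡ y) →
                (∀ {x} → P x → Walk x (f x)) → ∀ {x} → P x → Walk (f x) x
  return-walk f P f-closed f-injective advance {x} Px =
    let o , returns = iterate-returns Px in subst (Walk (f x)) returns (walk-to o)
    where
    open Iteration f P f-closed f-injective
    walk-to : ∀ i → Walk (f x) (iterate (ℕ.suc i) x)
    walk-to ℕ.zero    = []
    walk-to (ℕ.suc i) = walk-to i ++ᵂ advance (iterate-closed (ℕ.suc i) Px)

-- Perfect matchings and cuts

module _ (G : Graph) where
  open Graph G
  open import Data.Nat.Base using (_+_; _*_)

  end₁ end₂ : Fin m → Fin n
  end₁ e = proj₁ (ends e)
  end₂ e = proj₂ (ends e)

  IsEnd : Fin n → Fin m → Set
  IsEnd v e = v ≡ end₁ e ⊎ v ≡ end₂ e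

  lookup-∩-star : ∀ M v e → lookup (M ∩ star G v) e ≡ lookup M e ∧ incident G v e
  lookup-∩-star M v e = trans (lookup-∩ M (star G v) e) (cong (lookup M e ∧_) (lookup∘tabulate (incident G v) e))

  lookup-∇ : ∀ V₀ e → lookup (∇ G V₀) e ≡ lookup V₀ (end₁ e) xor lookup V₀ (end₂ e)
  lookup-∇ V₀ e = lookup∘tabulate _ e

  incident⇔IsEnd : ∀ v e → incident G v e ≡ true ⇔ IsEnd v e
  incident⇔IsEnd v e with v ≟ end₁ e | v ≟ end₂ e
  ... | yes v≡end₁ | _          = mk⇔ (λ _ → inj₁ v≡end₁) (λ _ → refl)
  ... | no  _      | yes v≡end₂ = mk⇔ (λ _ → inj₂ v≡end₂) (λ _ → refl)
  ... | no  v≢end₁ | no  v≢end₂ = mk⇔ (λ ()) λ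
    { (inj₁ v≡end₁) → ⊥-elim (v≢end₁ v≡end₁) ; (inj₂ v≡end₂) → ⊥-elim (v≢end₂ v≡end₂) }

  incident≡δ+δ : ∀ v e → incident G v e ≡ Parity.δ v (end₁ e) xor Parity.δ v (end₂ e)
  incident≡δ+δ v e with v ≟ end₁ e | v ≟ end₂ e
  ... | yes refl | yes v≡end₂ = ⊥-elim (loopless e v≡end₂)
  ... | yes _    | no  _      = refl
  ... | no  _    | yes _      = refl
  ... | no  _    | no  _      = refl

  bit-incident≡δ+δ : ∀ v e → bit (incident G v e) ≡ Count.δ v (end₁ e) + Count.δ v (end₂ e)
  bit-incident≡δ+δ v e with v ≟ end₁ e | v ≟ end₂ e
  ... | yes refl | yes v≡end₂ = ⊥-elim (loopless e v≡end₂)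
  ... | yes _    | no  _      = refl
  ... | no  _    | yes _      = refl
  ... | no  _    | no  _      = refl

  edge-at⇔ : ∀ M v e → lookup (M ∩ star G v) e ≡ true ⇔ (lookup M e ≡ true × IsEnd v e)
  edge-at⇔ M v e = mk⇔
    (λ M∋e∩v → let M∋e , incident = ∧-true⁻ (trans (sym (lookup-∩-star M v e)) M∋e∩v)
               in M∋e , Equivalence.to (incident⇔IsEnd v e) incident)
    (λ (M∋e , v∈e) → trans (lookup-∩-star M v e) (cong₂ _∧_ M∋e (Equivalence.from (incident⇔IsEnd v e) v∈e)))

  isPerfectMatching⇔ : ∀ M → IsPerfectMatching G M ⇔ (∀ v → ∃! _≡_ (λ e → lookup M e ≡ true × IsEnd v e))
  isPerfectMatching⇔ M = mk⇔
    (λ perfect v → ∃!-cong (edge-at⇔ M v) (∣p∣≡1⇒∃! (M ∩ star G v) (perfect v)))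
    (λ unique v → ∃!⇒∣p∣≡1 (M ∩ star G v) (∃!-cong (λ e → ⇔-sym (edge-at⇔ M v e)) (unique v)))

  module _ (M : EdgeSet G) (M-perfect : IsPerfectMatching G M) where

    parity-at : ∀ v → parity (M ∩ star G v) ≡ true
    parity-at v = bit-injective (trans (sym (∣p∣%2≡bit-parity (M ∩ star G v))) (cong (_% 2) (M-perfect v)))

    parity-∩-∇ : ∀ V₀ → parity (M ∩ ∇ G V₀) ≡ parity V₀
    parity-∩-∇ V₀ = sym (begin
      Parity.∑[ v < n ] lookup V₀ v
        ≡⟨ Parity.sum-cong-≋ {n} (λ v → sym (trans (cong (lookup V₀ v ∧_) (parity-at v)) (Bool.∧-identityʳ _))) ⟩
      Parity.∑[ v < n ] (lookup V₀ v ∧ parity (M ∩ star G v))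
        ≡⟨ Parity.sum-cong-≋ {n} (λ v → cong (lookup V₀ v ∧_) (Parity.sum-cong-≋ {m} (at v))) ⟩
      Parity.∑[ v < n ] (lookup V₀ v ∧ Parity.∑[ e < m ] (lookup M e ∧ d v e))
        ≡⟨ Parity.handshake end₁ end₂ (lookup M) (lookup V₀) ⟩
      Parity.∑[ e < m ] (lookup M e ∧ (lookup V₀ (end₁ e) xor lookup V₀ (end₂ e)))
        ≡⟨ Parity.sum-cong-≋ {m} (λ e → sym (trans (lookup-∩ M _ e) (cong (lookup M e ∧_) (lookup-∇ V₀ e)))) ⟩
      parity (M ∩ ∇ G V₀)
        ∎)
      where
      open ≡-Reasoning
      d : Fin n → Fin m → Bool
      d v e = Parity.δ v (end₁ e) xor Parity.δ v (end₂ e)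
      at : ∀ v e → lookup (M ∩ star G v) e ≡ lookup M e ∧ d v e
      at v e = trans (lookup-∩-star M v e) (cong (lookup M e ∧_) (incident≡δ+δ v e))

    ∣M∣*2≡n : ∣ M ∣ * 2 ≡ n
    ∣M∣*2≡n = sym (begin
      n
        ≡⟨ sym (∑1≡n n) ⟩
      Count.∑[ v < n ] 1
        ≡⟨ Count.sum-cong-≋ {n} (λ v → cong (1 *_) (sym (M-perfect v))) ⟩
      Count.∑[ v < n ] (1 * ∣ M ∩ star G v ∣)
        ≡⟨ Count.sum-cong-≋ {n} (λ v → cong (1 *_) (trans (∣p∣≡∑bit (M ∩ star G v)) (Count.sum-cong-≋ {m} (at v)))) ⟩
      Count.∑[ v < n ] (1 * Count.∑[ e < m ] (bit (lookup M e) * d v e))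
        ≡⟨ Count.handshake end₁ end₂ (λ e → bit (lookup M e)) (λ _ → 1) ⟩
      Count.∑[ e < m ] (bit (lookup M e) * 2)
        ≡⟨ sym (Count.*-distribʳ-sum 2 (λ e → bit (lookup M e))) ⟩
      Count.∑[ e < m ] bit (lookup M e) * 2
        ≡⟨ cong (_* 2) (sym (∣p∣≡∑bit M)) ⟩
      ∣ M ∣ * 2
        ∎)
      where
      open ≡-Reasoning
      d : Fin n → Fin m → ℕ
      d v e = Count.δ v (end₁ e) + Count.δ v (end₂ e)
      at : ∀ v e → bit (lookup (M ∩ star G v) e) ≡ bit (lookup M e) * d v e
      at v e = begin
        bit (lookup (M ∩ star G v) e)           ≡⟨ cong bit (lookup-∩-star M v e) ⟩
        bit (lookup M e ∧ incident G v e)       ≡⟨ bit-∧ (lookup M e) _ ⟩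
        bit (lookup M e) * bit (incident G v e) ≡⟨ cong (bit (lookup M e) *_) (bit-incident≡δ+δ v e) ⟩
        bit (lookup M e) * d v e                ∎

-- Switching

module _ (G : Graph) where
  open Graph G

  ParityInvariant : EdgeSet G → Set
  ParityInvariant X =
    ∀ M₁ M₂ → IsPerfectMatching G M₁ → IsPerfectMatching G M₂ → parity (M₁ ∩ X) ≡ parity (M₂ ∩ X)

  nonFeasible⇒parityInvariant : ∀ {X} → NonFeasible G X → ParityInvariant X
  nonFeasible⇒parityInvariant {X} nonFeasible M₁ M₂ M₁-perfect M₂-perfect
    with parity (M₁ ∩ X) Bool.≟ parity (M₂ ∩ X)
  ... | yes same   = same
  ... | no  differ =
    ⊥-elim (nonFeasible (M₁ , M₂ , M₁-perfect , M₂-perfect , differ ∘ %2≡⇒parity≡ (M₁ ∩ X) (M₂ ∩ X)))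

  parityInvariant⇒nonFeasible : ∀ {X} → ParityInvariant X → NonFeasible G X
  parityInvariant⇒nonFeasible {X} invariant (M₁ , M₂ , M₁-perfect , M₂-perfect , differ) =
    differ (parity≡⇒%2≡ (M₁ ∩ X) (M₂ ∩ X) (invariant M₁ M₂ M₁-perfect M₂-perfect))

  ⊕-assoc : ∀ X Y Z → _⊕_ G (_⊕_ G X Y) Z ≡ _⊕_ G X (_⊕_ G Y Z)
  ⊕-assoc = zipWith-assoc Bool.xor-assoc

  ⊕-cancelʳ : ∀ X Y → _⊕_ G (_⊕_ G X Y) Y ≡ X
  ⊕-cancelʳ X Y = begin
    _⊕_ G (_⊕_ G X Y) Y     ≡⟨ ⊕-assoc X Y Y ⟩
    _⊕_ G X (_⊕_ G Y Y)     ≡⟨ cong (_⊕_ G X) (trans (cong (_⊕_ G Y) (sym (map-id Y))) (zipWith-inverseʳ Bool.xor-same Y)) ⟩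
    _⊕_ G X (∅ₑ G)          ≡⟨ zipWith-identityʳ Bool.xor-identityʳ X ⟩
    X                       ∎
    where open ≡-Reasoning

  ∇-xor : ∀ U V → ∇ G (zipWith _xor_ U V) ≡ _⊕_ G (∇ G U) (∇ G V)
  ∇-xor U V = lookup-≗⇒≡ λ e → begin
    lookup (∇ G (zipWith _xor_ U V)) e
      ≡⟨ trans (lookup-∇ G (zipWith _xor_ U V) e) (cong₂ _xor_ (lookup-xor U V (end₁ G e)) (lookup-xor U V (end₂ G e))) ⟩
    (lookup U (end₁ G e) xor lookup V (end₁ G e)) xor (lookup U (end₂ G e) xor lookup V (end₂ G e))
      ≡⟨ interchange (lookup U (end₁ G e)) (lookup V (end₁ G e)) (lookup U (end₂ G e)) (lookup V (end₂ G e)) ⟩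
    (lookup U (end₁ G e) xor lookup U (end₂ G e)) xor (lookup V (end₁ G e) xor lookup V (end₂ G e))
      ≡⟨ sym (trans (lookup-xor (∇ G U) (∇ G V) e) (cong₂ _xor_ (lookup-∇ G U e) (lookup-∇ G V e))) ⟩
    lookup (_⊕_ G (∇ G U) (∇ G V)) e
      ∎
    where open ≡-Reasoning

  ∼-sym : ∀ {X Y} → _∼_ G X Y → _∼_ G Y X
  ∼-sym {Y = Y} (V , refl) = V , sym (⊕-cancelʳ Y (∇ G V))

  ∼-trans : ∀ {X Y Z} → _∼_ G X Y → _∼_ G Y Z → _∼_ G X Z
  ∼-trans {Z = Z} (V , refl) (U , refl) =
    zipWith _xor_ U V , trans (⊕-assoc Z (∇ G U) (∇ G V)) (cong (_⊕_ G Z) (sym (∇-xor U V)))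

  parityInvariant-∼ : ∀ {X Y} → _∼_ G X Y → ParityInvariant Y → ParityInvariant X
  parityInvariant-∼ {Y = Y} (V , refl) invariant M₁ M₂ M₁-perfect M₂-perfect = begin
    parity (M₁ ∩ _⊕_ G Y (∇ G V))            ≡⟨ parity-∩-xor M₁ Y (∇ G V) ⟩
    parity (M₁ ∩ Y) xor parity (M₁ ∩ ∇ G V)  ≡⟨ cong₂ _xor_ (invariant M₁ M₂ M₁-perfect M₂-perfect) cut-parity ⟩
    parity (M₂ ∩ Y) xor parity (M₂ ∩ ∇ G V)  ≡⟨ sym (parity-∩-xor M₂ Y (∇ G V)) ⟩
    parity (M₂ ∩ _⊕_ G Y (∇ G V))            ∎
    where
    open ≡-Reasoning
    cut-parity : parity (M₁ ∩ ∇ G V) ≡ parity (M₂ ∩ ∇ G V)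
    cut-parity = trans (parity-∩-∇ G M₁ M₁-perfect V) (sym (parity-∩-∇ G M₂ M₂-perfect V))

  nonFeasible-∼ : ∀ {X Y} → _∼_ G X Y → NonFeasible G Y → NonFeasible G X
  nonFeasible-∼ X∼Y = parityInvariant⇒nonFeasible ∘ parityInvariant-∼ X∼Y ∘ nonFeasible⇒parityInvariant

  nonFeasible-∅ : NonFeasible G (∅ₑ G)
  nonFeasible-∅ = parityInvariant⇒nonFeasible λ M₁ M₂ _ _ → cong parity (trans (∩-zeroʳ M₁) (sym (∩-zeroʳ M₂)))

  nonFeasible-E : NonFeasible G (Eₑ G)
  nonFeasible-E = parityInvariant⇒nonFeasible invariant
    where
    invariant : ParityInvariant (Eₑ G)
    invariant M₁ M₂ M₁-perfect M₂-perfect = begin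
      parity (M₁ ∩ Eₑ G) ≡⟨ cong parity (∩-identityʳ M₁) ⟩
      parity M₁          ≡⟨ %2≡⇒parity≡ M₁ M₂ (cong (_% 2) same-size) ⟩
      parity M₂          ≡⟨ cong parity (sym (∩-identityʳ M₂)) ⟩
      parity (M₂ ∩ Eₑ G) ∎
      where
      open ≡-Reasoning
      same-size : ∣ M₁ ∣ ≡ ∣ M₂ ∣
      same-size = ℕ.*-cancelʳ-≡ ∣ M₁ ∣ ∣ M₂ ∣ 2
                    (trans (∣M∣*2≡n G M₁ M₁-perfect) (sym (∣M∣*2≡n G M₂ M₂-perfect)))

  bipartite⇔E∼∅ : Bipartite G ⇔ _∼_ G (Eₑ G) (∅ₑ G)
  bipartite⇔E∼∅ = mk⇔
    (λ (c , proper) → c , lookup-≗⇒≡ λ e →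
       trans (lookup-replicate e true) (sym (trans (lookup-∅⊕∇ c e) (≢⇒xor (proper e)))))
    (λ (c , E≡∇c) → c , λ e →
       xor⇒≢ (trans (sym (lookup-∅⊕∇ c e)) (trans (cong (λ X → lookup X e) (sym E≡∇c)) (lookup-replicate e true))))
    where
    xor⇒≢ : ∀ {x y} → x xor y ≡ true → x ≢ y
    xor⇒≢ {false} {true}  _ ()
    xor⇒≢ {true}  {false} _ ()
    ≢⇒xor : ∀ {x y} → x ≢ y → x xor y ≡ true
    ≢⇒xor {false} {false} x≢y = ⊥-elim (x≢y refl)
    ≢⇒xor {false} {true}  _   = refl
    ≢⇒xor {true}  {false} _   = refl
    ≢⇒xor {true}  {true}  x≢y = ⊥-elim (x≢y refl)
    lookup-∅⊕∇ : ∀ V e → lookup (_⊕_ G (∅ₑ G) (∇ G V)) e ≡ lookup V (end₁ G e) xor lookup V (end₂ G e)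
    lookup-∅⊕∇ V e = trans (lookup-xor (∅ₑ G) (∇ G V) e) (cong₂ _xor_ (lookup-replicate e false) (lookup-∇ G V e))

module PerfectMatching (G : Graph) (M : EdgeSet G) (M-perfect : IsPerfectMatching G M) where
  open Graph G

  private
    edge-at : ∀ v → ∃! _≡_ (λ e → lookup M e ≡ true × IsEnd G v e)
    edge-at = Equivalence.to (isPerfectMatching⇔ G M) M-perfect

  matched : Fin n → Fin m
  matched v = proj₁ (edge-at v)

  matched-∈ : ∀ v → lookup M (matched v) ≡ true
  matched-∈ v = proj₁ (proj₁ (proj₂ (edge-at v)))

  matched-end : ∀ v → IsEnd G v (matched v)
  matched-end v = proj₂ (proj₁ (proj₂ (edge-at v)))

  matched-unique : ∀ {v e} → lookup M e ≡ true → IsEnd G v e → matched v ≡ e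
  matched-unique {v} M∋e v∈e = proj₂ (proj₂ (edge-at v)) (M∋e , v∈e)

  ∼-avoiding : ∀ X → ∃[ Y ] (_∼_ G Y X × ∀ e → lookup M e ≡ true → lookup Y e ≡ false)
  ∼-avoiding X = _⊕_ G X (∇ G V₀) , (V₀ , refl) , Y∩M≡∅
    where
    V₀ : Subset n
    V₀ = tabulate (λ v → does (v ≟ end₂ G (matched v)) ∧ lookup X (matched v))
    Y∩M≡∅ : ∀ e → lookup M e ≡ true → lookup (_⊕_ G X (∇ G V₀)) e ≡ false
    Y∩M≡∅ e M∋e = begin
      lookup (_⊕_ G X (∇ G V₀)) e
        ≡⟨ trans (lookup-xor X (∇ G V₀) e) (cong (lookup X e xor_) (lookup-∇ G V₀ e)) ⟩
      lookup X e xor (lookup V₀ (end₁ G e) xor lookup V₀ (end₂ G e))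
        ≡⟨ cong (lookup X e xor_) (cong₂ _xor_ V₀∌end₁ V₀-end₂) ⟩
      lookup X e xor lookup X e
        ≡⟨ Bool.xor-same (lookup X e) ⟩
      false
        ∎
      where
      open ≡-Reasoning
      V₀-at : ∀ {v} → IsEnd G v e → lookup V₀ v ≡ does (v ≟ end₂ G e) ∧ lookup X e
      V₀-at {v} v∈e =
        trans (lookup∘tabulate _ v) (cong (λ f → does (v ≟ end₂ G f) ∧ lookup X f) (matched-unique M∋e v∈e))
      V₀∌end₁ : lookup V₀ (end₁ G e) ≡ false
      V₀∌end₁ = trans (V₀-at (inj₁ refl)) (cong (_∧ lookup X e) (dec-false (end₁ G e ≟ end₂ G e) (loopless e)))
      V₀-end₂ : lookup V₀ (end₂ G e) ≡ lookup X e
      V₀-end₂ = trans (V₀-at (inj₂ refl)) (cong (_∧ lookup X e) (dec-true (end₂ G e ≟ end₂ G e) refl))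

-- The contraction of a perfect matching of a bipartite graph

module Bipartition (G : Graph) (c : Vec Bool (Graph.n G))
                   (proper : ∀ e → lookup c (end₁ G e) ≢ lookup c (end₂ G e)) where
  open Graph G

  colour : Fin n → Bool
  colour = lookup c

  aEnd bEnd : Fin m → Fin n
  aEnd e = if colour (end₁ G e) then end₁ G e else end₂ G e
  bEnd e = if colour (end₁ G e) then end₂ G e else end₁ G e

  colour-end₂ : ∀ e → colour (end₂ G e) ≡ not (colour (end₁ G e))
  colour-end₂ e = Bool.¬-not (≢-sym (proper e))

  colour-aEnd : ∀ e → colour (aEnd e) ≡ true
  colour-aEnd e with colour (end₁ G e) in colour₁
  ... | true  = colour₁
  ... | false = trans (colour-end₂ e) (cong not colour₁)

  colour-bEnd : ∀ e → colour (bEnd e) ≡ false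
  colour-bEnd e with colour (end₁ G e) in colour₁
  ... | true  = trans (colour-end₂ e) (cong not colour₁)
  ... | false = colour₁

  aEnd-end : ∀ e → IsEnd G (aEnd e) e
  aEnd-end e with colour (end₁ G e)
  ... | true  = inj₁ refl
  ... | false = inj₂ refl

  bEnd-end : ∀ e → IsEnd G (bEnd e) e
  bEnd-end e with colour (end₁ G e)
  ... | true  = inj₂ refl
  ... | false = inj₁ refl

  end-by-colour : ∀ {v e} → IsEnd G v e → v ≡ (if colour v then aEnd e else bEnd e)
  end-by-colour {e = e} (inj₁ refl) with colour (end₁ G e)
  ... | true  = refl
  ... | false = refl
  end-by-colour {e = e} (inj₂ refl) rewrite colour-end₂ e with colour (end₁ G e)
  ... | true  = refl
  ... | false = refl

  end-aEnd : ∀ {v e} → IsEnd G v e → colour v ≡ true → v ≡ aEnd e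
  end-aEnd {e = e} v∈e colour-v = trans (end-by-colour v∈e) (cong (if_then aEnd e else bEnd e) colour-v)

  end-bEnd : ∀ {v e} → IsEnd G v e → colour v ≡ false → v ≡ bEnd e
  end-bEnd {e = e} v∈e colour-v = trans (end-by-colour v∈e) (cong (if_then aEnd e else bEnd e) colour-v)

  xor-ends : ∀ (f : Fin n → Bool) e → f (end₁ G e) xor f (end₂ G e) ≡ f (aEnd e) xor f (bEnd e)
  xor-ends f e with colour (end₁ G e)
  ... | true  = refl
  ... | false = Bool.xor-comm (f (end₁ G e)) (f (end₂ G e))

module Contraction (G : Graph) (c : Vec Bool (Graph.n G))
                   (proper : ∀ e → lookup c (end₁ G e) ≢ lookup c (end₂ G e))
                   (M₀ : EdgeSet G) (M₀-perfect : IsPerfectMatching G M₀) where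
  open Graph G
  open Bipartition G c proper
  open PerfectMatching G M₀ M₀-perfect

  -- The contraction map: every M₀-edge is collapsed onto its end of colour true.
  rep : Fin n → Fin n
  rep v = aEnd (matched v)

  rep-true : ∀ {v} → colour v ≡ true → rep v ≡ v
  rep-true colour-v = sym (end-aEnd (matched-end _) colour-v)

  colour-rep : ∀ v → colour (rep v) ≡ true
  colour-rep v = colour-aEnd (matched v)

  rep-injective : ∀ {u v} → colour u ≡ colour v → rep u ≡ rep v → u ≡ v
  rep-injective {u} {v} same rep≡ with colour u in colour-u
  ... | true  = trans (sym (rep-true colour-u)) (trans rep≡ (rep-true (sym same)))
  ... | false = begin
    u                 ≡⟨ end-bEnd (matched-end u) colour-u ⟩
    bEnd (matched u)  ≡⟨ cong bEnd (trans (sym (matched-unique (matched-∈ u) at-u)) (matched-unique (matched-∈ v) at-v)) ⟩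
    bEnd (matched v)  ≡⟨ sym (end-bEnd (matched-end v) (sym same)) ⟩
    v                 ∎
    where
    open ≡-Reasoning
    at-u : IsEnd G (rep u) (matched u)
    at-u = aEnd-end (matched u)
    at-v : IsEnd G (rep u) (matched v)
    at-v = subst (λ x → IsEnd G x (matched v)) (sym rep≡) (aEnd-end (matched v))

  src tgt : Fin m → Fin n
  src e = rep (aEnd e)
  tgt e = rep (bEnd e)

  src-matched : ∀ v → src (matched v) ≡ rep v
  src-matched v = rep-true (colour-aEnd (matched v))

  rep≡src : ∀ {v e} → IsEnd G v e → colour v ≡ true → rep v ≡ src e
  rep≡src v∈e colour-v = cong rep (end-aEnd v∈e colour-v)

  rep≡tgt : ∀ {v e} → IsEnd G v e → colour v ≡ false → rep v ≡ tgt e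
  rep≡tgt v∈e colour-v = cong rep (end-bEnd v∈e colour-v)

  -- The hypotheses say that the arcs as form vertex-disjoint cycles of the contraction;
  -- exchanging M₀ along them gives a perfect matching.
  module Exchange (as : List (Fin m)) (targets-unique : Unique (map tgt as)) (balanced : map src as ↭ map tgt as) where

    T : List (Fin n)
    T = map tgt as

    sources-unique : Unique (map src as)
    sources-unique = Unique-resp-↭ (↭-sym balanced) targets-unique

    exchanged : EdgeSet G
    exchanged = tabulate (λ e → does (e ∈? as) ∨ (lookup M₀ e ∧ not (does (src e ∈? T))))

    exchanged⇒ : ∀ e → lookup exchanged e ≡ true → e ∈ as ⊎ (lookup M₀ e ≡ true × src e ∉ T)
    exchanged⇒ e e∈ with e ∈? as | trans (sym (lookup∘tabulate _ e)) e∈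
    ... | yes e∈as | _ = inj₁ e∈as
    ... | no  _    | M₀∧ with src e ∈? T | ∧-true⁻ {lookup M₀ e} M₀∧
    ... | no src∉T | M₀∋e , _ = inj₂ (M₀∋e , src∉T)

    exchanged-arc : ∀ {e} → e ∈ as → lookup exchanged e ≡ true
    exchanged-arc {e} e∈as =
      trans (lookup∘tabulate _ e) (cong (_∨ (lookup M₀ e ∧ not (does (src e ∈? T)))) (dec-true (e ∈? as) e∈as))

    exchanged-matched : ∀ {v} → rep v ∉ T → lookup exchanged (matched v) ≡ true
    exchanged-matched {v} rep∉T = begin
      lookup exchanged (matched v)
        ≡⟨ lookup∘tabulate _ (matched v) ⟩
      does (matched v ∈? as) ∨ (lookup M₀ (matched v) ∧ not (does (src (matched v) ∈? T)))
        ≡⟨ cong₂ (λ x y → does (matched v ∈? as) ∨ (x ∧ not y))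
                 (matched-∈ v) (dec-false (src (matched v) ∈? T) src∉T) ⟩
      does (matched v ∈? as) ∨ true
        ≡⟨ Bool.∨-zeroʳ _ ⟩
      true
        ∎
      where
      open ≡-Reasoning
      src∉T : src (matched v) ∉ T
      src∉T = rep∉T ∘ subst (_∈ T) (src-matched v)

    exchanged-∖M₀ : ∀ e → lookup M₀ e ≡ false → lookup exchanged e ≡ does (e ∈? as)
    exchanged-∖M₀ e M₀∌e = trans (lookup∘tabulate _ e)
      (trans (cong (λ x → does (e ∈? as) ∨ (x ∧ not (does (src e ∈? T)))) M₀∌e) (Bool.∨-identityʳ _))

    arc-end∈T : ∀ {e v} → e ∈ as → IsEnd G v e → rep v ∈ T
    arc-end∈T {e} {v} e∈as v∈e with colour v in colour-v
    ... | true  = subst (_∈ T) (sym (rep≡src v∈e colour-v)) (∈-resp-↭ balanced (∈-map⁺ src e∈as))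
    ... | false = subst (_∈ T) (sym (rep≡tgt v∈e colour-v)) (∈-map⁺ tgt e∈as)

    arc-at : ∀ {v} → rep v ∈ T → ∃[ e ] (e ∈ as × IsEnd G v e)
    arc-at {v} rep∈T with colour v in colour-v
    ... | true  = let e , e∈as , rep≡ = ∈-map⁻ src (∈-resp-↭ (↭-sym balanced) rep∈T)
                  in e , e∈as , subst (λ x → IsEnd G x e)
                                   (sym (rep-injective (trans colour-v (sym (colour-aEnd e))) rep≡)) (aEnd-end e)
    ... | false = let e , e∈as , rep≡ = ∈-map⁻ tgt rep∈T
                  in e , e∈as , subst (λ x → IsEnd G x e)
                                   (sym (rep-injective (trans colour-v (sym (colour-bEnd e))) rep≡)) (bEnd-end e)

    arcs-at-unique : ∀ {e e′ v} → e ∈ as → e′ ∈ as → IsEnd G v e → IsEnd G v e′ → e ≡ e′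
    arcs-at-unique {v = v} e∈as e′∈as v∈e v∈e′ with colour v in colour-v
    ... | true  = Unique-map⇒injective src sources-unique e∈as e′∈as
                    (trans (sym (rep≡src v∈e colour-v)) (rep≡src v∈e′ colour-v))
    ... | false = Unique-map⇒injective tgt targets-unique e∈as e′∈as
                    (trans (sym (rep≡tgt v∈e colour-v)) (rep≡tgt v∈e′ colour-v))

    exchanged-perfect : IsPerfectMatching G exchanged
    exchanged-perfect = Equivalence.from (isPerfectMatching⇔ G exchanged) unique-at
      where
      unique-at : ∀ v → ∃! _≡_ (λ e → lookup exchanged e ≡ true × IsEnd G v e)
      unique-at v with rep v ∈? T
      ... | no rep∉T = matched v , (exchanged-matched rep∉T , matched-end v) , only
        where
        only : ∀ {j} → lookup exchanged j ≡ true × IsEnd G v j → matched v ≡ j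
        only (j∈ , v∈j) with exchanged⇒ _ j∈
        ... | inj₁ j∈as         = ⊥-elim (rep∉T (arc-end∈T j∈as v∈j))
        ... | inj₂ (M₀∋j , _)   = matched-unique M₀∋j v∈j
      ... | yes rep∈T with arc-at rep∈T
      ... | e , e∈as , v∈e = e , (exchanged-arc e∈as , v∈e) , only
        where
        only : ∀ {j} → lookup exchanged j ≡ true × IsEnd G v j → e ≡ j
        only (j∈ , v∈j) with exchanged⇒ _ j∈
        ... | inj₁ j∈as           = arcs-at-unique e∈as j∈as v∈e v∈j
        ... | inj₂ (M₀∋j , src∉T) =
          ⊥-elim (src∉T (subst (_∈ T) (trans (sym (src-matched v)) (cong src (matched-unique M₀∋j v∈j))) rep∈T))

  module _ (Y : EdgeSet G) where
    open Digraph src tgt (lookup Y)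

    arc-walk : ∀ e {u v} → IsEnd G u e → IsEnd G v e → colour u ≡ true → colour v ≡ false → Walk (rep u) (rep v)
    arc-walk e u∈e v∈e colour-u colour-v = subst₂ Walk (sym (rep≡src u∈e colour-u)) (sym (rep≡tgt v∈e colour-v)) (e ∷ [])

    -- Follows the cycle of M ⊕ M₀ through e.
    back-walk : ∀ M → IsPerfectMatching G M → ∀ {e} → lookup M e ≡ true → Walk (tgt e) (src e)
    back-walk M M-perfect {e} M∋e =
      subst (λ x → Walk x (src e)) (cong tgt (M.matched-unique M∋e src∈e))
        (return-walk next (λ x → colour x ≡ true) (λ {x} _ → colour-rep (bEnd (M.matched x))) next-injective
                     advance (colour-rep (aEnd e)))
      where
      module M = PerfectMatching G M M-perfect
      next : Fin n → Fin n
      next x = tgt (M.matched x)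
      src∈e : IsEnd G (src e) e
      src∈e = subst (λ x → IsEnd G x e) (sym (rep-true (colour-aEnd e))) (aEnd-end e)
      advance : ∀ {x} → colour x ≡ true → Walk x (next x)
      advance {x} colour-x = subst₂ Walk (rep-true colour-x) refl
                            (arc-walk (M.matched x) (M.matched-end x) (bEnd-end (M.matched x)) colour-x (colour-bEnd _))
      next-injective : ∀ {x y} → colour x ≡ true → colour y ≡ true → next x ≡ next y → x ≡ y
      next-injective {x} {y} colour-x colour-y next≡ = begin
        x                    ≡⟨ end-aEnd (M.matched-end x) colour-x ⟩
        aEnd (M.matched x)   ≡⟨ cong aEnd same-edge ⟩
        aEnd (M.matched y)   ≡⟨ sym (end-aEnd (M.matched-end y) colour-y) ⟩
        y                    ∎
        where
        open ≡-Reasoning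
        b : Fin n
        b = bEnd (M.matched x)
        b∈y : IsEnd G b (M.matched y)
        b∈y = subst (λ z → IsEnd G z (M.matched y))
                (rep-injective (trans (colour-bEnd _) (sym (colour-bEnd _))) (sym next≡)) (bEnd-end (M.matched y))
        same-edge : M.matched x ≡ M.matched y
        same-edge = trans (sym (M.matched-unique (M.matched-∈ x) (bEnd-end (M.matched x))))
                          (M.matched-unique (M.matched-∈ y) b∈y)

    module _ (covered : ∀ e → ∃[ M ] (IsPerfectMatching G M × lookup M e ≡ true)) where

      edge-walk : ∀ e {u v} → IsEnd G u e → IsEnd G v e → colour u ≢ colour v → Walk (rep u) (rep v)
      edge-walk e {u} {v} u∈e v∈e differ with colour u in colour-u | colour v in colour-v
      ... | true  | false = arc-walk e u∈e v∈e colour-u colour-v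
      ... | false | true  = let M , M-perfect , M∋e = covered e in
                            subst₂ Walk (sym (rep≡tgt u∈e colour-u)) (sym (rep≡src v∈e colour-v)) (back-walk M M-perfect M∋e)
      ... | true  | true  = ⊥-elim (differ refl)
      ... | false | false = ⊥-elim (differ refl)

      adjacent-walk : ∀ {u v} → Adjacent G u v → Walk (rep u) (rep v)
      adjacent-walk {u} {v} (e , inj₁ ends≡) =
        edge-walk e (inj₁ (cong proj₁ (sym ends≡))) (inj₂ (cong proj₂ (sym ends≡)))
          (subst₂ (λ x y → colour x ≢ colour y) (cong proj₁ ends≡) (cong proj₂ ends≡) (proper e))
      adjacent-walk {u} {v} (e , inj₂ ends≡) =
        edge-walk e (inj₂ (cong proj₂ (sym ends≡))) (inj₁ (cong proj₁ (sym ends≡)))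
          (subst₂ (λ x y → colour x ≢ colour y) (cong proj₂ ends≡) (cong proj₁ ends≡) (≢-sym (proper e)))

      reachable-walk : ∀ {u v} → Reachable G u v → Walk (rep u) (rep v)
      reachable-walk here              = []
      reachable-walk (step adjacent r) = adjacent-walk adjacent ++ᵂ reachable-walk r

      module _ (Y-invariant : ParityInvariant G Y) (Y∩M₀≡∅ : ∀ e → lookup M₀ e ≡ true → lookup Y e ≡ false) where

        simple-cycle-even : ∀ {x} (C : Walk x x) → SimpleCycle C → weight C ≡ false
        simple-cycle-even C targets-unique = begin
          weight C
            ≡⟨ sym (∑-∈ (lookup Y) (Unique.map⁻ targets-unique)) ⟩
          Parity.∑[ e < m ] (does (e ∈? arcs C) ∧ lookup Y e)
            ≡⟨ Parity.sum-cong-≋ {m} (λ e → sym (trans (lookup-∩ exchanged Y e) (on-exchanged e))) ⟩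
          parity (exchanged ∩ Y)
            ≡⟨ Y-invariant exchanged M₀ exchanged-perfect M₀-perfect ⟩
          parity (M₀ ∩ Y)
            ≡⟨ trans (Parity.sum-cong-≋ {m} (λ e → trans (lookup-∩ M₀ Y e) (on-M₀ e))) (Parity.sum-replicate-zero m) ⟩
          false
            ∎
          where
          open ≡-Reasoning
          open Exchange (arcs C) targets-unique (closed-sources↭targets C)
          on-exchanged : ∀ e → lookup exchanged e ∧ lookup Y e ≡ does (e ∈? arcs C) ∧ lookup Y e
          on-exchanged e with lookup Y e in Y∋e | lookup M₀ e in M₀∋e
          ... | false | _     = trans (Bool.∧-zeroʳ _) (sym (Bool.∧-zeroʳ _))
          ... | true  | false = cong (_∧ true) (exchanged-∖M₀ e M₀∋e)
          ... | true  | true  = contradiction (trans (sym Y∋e) (Y∩M₀≡∅ e M₀∋e)) λ ()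
          on-M₀ : ∀ e → lookup M₀ e ∧ lookup Y e ≡ false
          on-M₀ e with lookup M₀ e in M₀∋e
          ... | false = refl
          ... | true  = Y∩M₀≡∅ e M₀∋e

        invariant-avoiding⇒∼∅ : Connected G → Fin n → _∼_ G Y (∅ₑ G)
        invariant-avoiding⇒∼∅ connected root = tabulate potential , lookup-≗⇒≡ λ e → sym (begin
          lookup (_⊕_ G (∅ₑ G) (∇ G (tabulate potential))) e
            ≡⟨ trans (lookup-xor (∅ₑ G) _ e) (cong₂ _xor_ (lookup-replicate e false) (lookup-∇ G (tabulate potential) e)) ⟩
          lookup (tabulate potential) (end₁ G e) xor lookup (tabulate potential) (end₂ G e)
            ≡⟨ cong₂ _xor_ (lookup∘tabulate potential _) (lookup∘tabulate potential _) ⟩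
          potential (end₁ G e) xor potential (end₂ G e)
            ≡⟨ xor-ends potential e ⟩
          potential (aEnd e) xor potential (bEnd e)
            ≡⟨ xor-transpose (potential (aEnd e)) (trans (sym (weight-++ (walk-to (aEnd e)) (e ∷ []))) through-e) ⟩
          lookup Y e xor false
            ≡⟨ Bool.xor-identityʳ (lookup Y e) ⟩
          lookup Y e
            ∎)
          where
          open ≡-Reasoning
          walk-to : ∀ v → Walk (rep root) (rep v)
          walk-to v = reachable-walk (connected root v)
          potential : Fin n → Bool
          potential v = weight (walk-to v)
          through-e : ∀ {e} → weight (walk-to (aEnd e) ++ᵂ e ∷ []) ≡ weight (walk-to (bEnd e))
          through-e {e} = weight-unique simple-cycle-even (walk-to (aEnd e) ++ᵂ e ∷ []) (walk-to (bEnd e))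
                            (reachable-walk (connected (bEnd e) root))

edge-or-none : ∀ k → Fin k ⊎ ¬ Fin k
edge-or-none ℕ.zero    = inj₂ ¬Fin0
edge-or-none (ℕ.suc k) = inj₁ zero

nonFeasible⇒∼∅ : ∀ G → MatchingCovered G → Bipartite G → ∀ X → NonFeasible G X → _∼_ G X (∅ₑ G)
nonFeasible⇒∼∅ G (connected , covered) (c , proper) X nonFeasible with edge-or-none (Graph.m G)
... | inj₂ no-edge = ⊥ , lookup-≗⇒≡ (λ e → ⊥-elim (no-edge e))
... | inj₁ e₀ with covered e₀
... | M₀ , M₀-perfect , _ with PerfectMatching.∼-avoiding G M₀ M₀-perfect X
... | Y , Y∼X , Y∩M₀≡∅ = ∼-trans G (∼-sym G Y∼X)
  (Contraction.invariant-avoiding⇒∼∅ G c proper M₀ M₀-perfect Y covered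
     (nonFeasible⇒parityInvariant G (nonFeasible-∼ G Y∼X nonFeasible)) Y∩M₀≡∅ connected (end₁ G e₀))

characterisation : ∀ G → MatchingCovered G → ∀ {Z} → NonFeasible G Z →
                   Bipartite G ⇔ (∀ X → NonFeasible G X ⇔ _∼_ G X Z)
characterisation G covered {Z} Z-nonFeasible = mk⇔
  (λ bipartite X → mk⇔
     (λ X-nonFeasible → ∼-trans G (nonFeasible⇒∼∅ G covered bipartite X X-nonFeasible)
                                  (∼-sym G (nonFeasible⇒∼∅ G covered bipartite Z Z-nonFeasible)))
     (λ X∼Z → nonFeasible-∼ G X∼Z Z-nonFeasible))
  (λ characterised → Equivalence.from (bipartite⇔E∼∅ G)
     (∼-trans G (Equivalence.to (characterised (Eₑ G)) (nonFeasible-E G))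
                (∼-sym G (Equivalence.to (characterised (∅ₑ G)) (nonFeasible-∅ G)))))

theorem1p3 : (G : Graph) → MatchingCovered G →
    (Bipartite G ⇔ (∀ X → NonFeasible G X ⇔ _∼_ G X (∅ₑ G)))
    × (Bipartite G ⇔ (∀ X → NonFeasible G X ⇔ _∼_ G X (Eₑ G)))
theorem1p3 G covered = characterisation G covered (nonFeasible-∅ G) , characterisation G covered (nonFeasible-E G)
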